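{- Let $m\ge2$ and $n\ge1$ be integers. Then \[ \sum_{k=0}^{n-1}T^{(m-1)}_{n,k}=T^{(m)}_{n,n-1}. \]
   Context: For integers $r\ge1$, $n\ge1$: an $r$-Stirling permutation of order $n$ is a word $a_1a_2\cdots a_{rn}$ that is a permutation of the multiset in which each of $1,2,\dots,n$ occurs exactly $r$ times, such that whenever $u<v<w$ and $a_u=a_w$, one has $a_u\ge a_v$. A descent of such a word is an index $j\in\{1,\dots,rn-1\}$ with $a_j>a_{j+1}$. $T^{(r)}_{n,k}$ is the number of $r$-Stirling permutations of order $n$ with exactly $k$ descents; $T^{(r)}_{n,k}=0$ for $k<0$ or $k\ge n$. -}

module Defs where

open import Data.Nat using (ℕ; zero; suc; _+_; _*_; _∸_; _≤ᵇ_; _<ᵇ_; _≡ᵇ_)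
open import Data.Bool using (Bool; true; false; _∧_; if_then_else_)
open import Data.List using (List; []; _∷_; map; concatMap; filter; length; upTo)
open import Data.Bool.Properties using (T?)

words : ℕ → ℕ → List (List ℕ)
words n zero    = [] ∷ []
words n (suc L) = concatMap (λ a → map (a ∷_) (words n L)) (map suc (upTo n))

allB : {A : Set} → (A → Bool) → List A → Bool
allB p []       = true
allB p (x ∷ xs) = p x ∧ allB p xs

occ : ℕ → List ℕ → ℕ
occ i []       = 0
occ i (x ∷ xs) = if x ≡ᵇ i then suc (occ i xs) else occ i xs

-- the word is a permutation of the multiset {1^r, 2^r, …, n^r}
-- (given that all letters lie in {1,…,n}, which holds for elements of 'words n L')
isMultisetPerm : ℕ → ℕ → List ℕ → Bool
isMultisetPerm r n w = allB (λ i → occ (suc i) w ≡ᵇ r) (upTo n)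

-- Stirling condition: for all u < v < w with a_u = a_w we have a_u ≥ a_v.
-- For fixed u (value a) and each v after u with a_v > a, there must be no
-- w after v with a_w = a.
noLater : ℕ → List ℕ → Bool
noLater a []       = true
noLater a (x ∷ xs) = if x ≡ᵇ a then false else noLater a xs

condFrom : ℕ → List ℕ → Bool
condFrom a []       = true
condFrom a (b ∷ xs) = (if a <ᵇ b then noLater a xs else true) ∧ condFrom a xs

isStirlingCond : List ℕ → Bool
isStirlingCond []       = true
isStirlingCond (a ∷ xs) = condFrom a xs ∧ isStirlingCond xs

descents : List ℕ → ℕ
descents []           = 0
descents (x ∷ [])     = 0
descents (x ∷ y ∷ xs) = (if y <ᵇ x then 1 else 0) + descents (y ∷ xs)

stirlingPerms : ℕ → ℕ → List (List ℕ)
stirlingPerms r n =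
  filter (λ w → T? (isMultisetPerm r n w ∧ isStirlingCond w)) (words n (r * n))

-- T^{(r)}_{n,k}: number of r-Stirling permutations of order n with exactly k descents
-- (automatically 0 for k ≥ n, since no such permutation exists)
Tr : ℕ → ℕ → ℕ → ℕ
Tr r n k = length (filter (λ w → T? (descents w ≡ᵇ k)) (stirlingPerms r n))

sumBelow : ℕ → (ℕ → ℕ) → ℕ
sumBelow zero    f = 0
sumBelow (suc N) f = sumBelow N f + f N

-- Deleting the r letters 1 of an r-Stirling permutation of order n + 1 (the Stirling condition
-- forces them to form one block) and lowering every other letter by one leaves an r-Stirling
-- permutation of order n; conversely, inserting the block 1^r into each of the rn + 1 slots of
-- a raised permutation of order n produces every permutation of order n + 1 exactly once.
-- Inserting at the front or into a descent keeps the number of descents and every other slot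
-- adds one, whence T(n+1, k) = (k + 1) T(n, k) + (rn − k + 1) T(n, k − 1). Summed over k this
-- multiplies the row sum by rn + 1, so the row sum of order n + 1 is ∏_{i=1}^{n} (ri + 1).
-- For r + 1 at the top index, T(n, n) = 0 leaves T(n+1, n) = (rn + 1) T(n, n − 1): the same product.

module Submission where

open import Defs

open import Algebra.Properties.CommutativeSemigroup using (interchange)
open import Data.Bool using (Bool; true; false; T; if_then_else_; _∧_)
open import Data.Bool.Properties using (T?; T-∧; T-≡)
open import Data.List using (List; []; _∷_; _++_; [_]; map; concatMap; filter; length; replicate; upTo)
open import Data.List.Properties
  using (filter-++; filter-all; filter-none; length-++; length-map; length-replicate; map-++; map-∘; map-id;
         map-replicate; map-cong-local; ∷-injectiveˡ; ∷-injectiveʳ)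
open import Data.List.Membership.Propositional using (_∈_; find; lose)
open import Data.List.Membership.Propositional.Properties
  using (∈-map⁺; ∈-map⁻; map∷⁻; ∈-upTo⁺; ∈-upTo⁻; ∈-concatMap⁺; ∈-concatMap⁻; ∈-filter⁺; ∈-filter⁻)
open import Data.List.Membership.Propositional.Properties.WithK using (unique∧set⇒bag)
open import Data.List.Relation.Binary.BagAndSetEquality using (∼bag⇒↭)
open import Data.List.Relation.Binary.Permutation.Propositional
  using (_↭_; ↭-sym; ↭-reflexive; prep; module PermutationReasoning)
open import Data.List.Relation.Binary.Permutation.Propositional.Properties
  using (↭-length; filter-↭; shift; shifts; All-resp-↭) renaming (map⁺ to ↭-map⁺)
open import Data.List.Relation.Unary.All as All using (All; []; _∷_)
import Data.List.Relation.Unary.All.Properties as All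
open import Data.List.Relation.Unary.Any using (here; there)
open import Data.List.Relation.Unary.Unique.Propositional using (Unique; []; _∷_)
open import Data.List.Relation.Unary.Unique.Propositional.Properties
  using (++⁺; upTo⁺) renaming (map⁺ to unique-map⁺; filter⁺ to unique-filter⁺)
open import Data.Nat using (ℕ; zero; suc; pred; _+_; _*_; _∸_; _≤_; _<_; _≡ᵇ_; _<ᵇ_; z≤n; s≤s)
open import Data.Nat.ListAction using (sum)
open import Data.Nat.Properties
  using (_≟_; suc-injective; ≡ᵇ⇒≡; ≡⇒≡ᵇ; ≤-refl; ≤-pred; <⇒≤; <⇒≢; >⇒≢; m<n⇒m<1+n; m≤n*m; +-suc;
         +-identityʳ; +-cancelˡ-≡; *-identityˡ; *-zeroʳ; *-suc; 0∸n≡0; m+n∸n≡m; m+n∸m≡n; m+[n∸m]≡n;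
         +-commutativeSemigroup)
open import Data.Nat.Tactic.RingSolver using (solve-∀)
open import Data.Product using (∃-syntax; ∃₂; _×_; _,_; proj₁; proj₂)
open import Data.Product.Function.NonDependent.Propositional using (_×-⇔_)
open import Function using (_∘_)
open import Function.Bundles using (_⇔_; mk⇔; Equivalence)
open import Relation.Binary.PropositionalEquality
  using (_≡_; _≢_; refl; sym; trans; cong; cong₂; subst; module ≡-Reasoning)
open import Relation.Nullary.Decidable using (¬?)

private variable
  A B : Set

count : (A → Bool) → List A → ℕ
count p = length ∘ filter (T? ∘ p)

count-∷ : ∀ (p : A → Bool) x xs → count p (x ∷ xs) ≡ (if p x then 1 else 0) + count p xs
count-∷ p x xs with p x
... | true  = refl
... | false = refl

count-++ : ∀ (p : A → Bool) xs ys → count p (xs ++ ys) ≡ count p xs + count p ys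
count-++ p xs ys = trans (cong length (filter-++ (T? ∘ p) xs ys)) (length-++ (filter (T? ∘ p) xs))

count-map : ∀ (p : B → Bool) (f : A → B) xs → count p (map f xs) ≡ count (p ∘ f) xs
count-map p f []       = refl
count-map p f (x ∷ xs) rewrite count-∷ p (f x) (map f xs) | count-∷ (p ∘ f) x xs =
  cong ((if p (f x) then 1 else 0) +_) (count-map p f xs)

count-replicate : ∀ (p : A → Bool) n x → count p (replicate n x) ≡ (if p x then n else 0)
count-replicate p zero    x with p x
... | true  = refl
... | false = refl
count-replicate p (suc n) x rewrite count-∷ p x (replicate n x) | count-replicate p n x with p x
... | true  = refl
... | false = refl

count-concatMap : ∀ (p : B → Bool) (f : A → List B) xs →
  count p (concatMap f xs) ≡ sum (map (count p ∘ f) xs)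
count-concatMap p f []       = refl
count-concatMap p f (x ∷ xs) =
  trans (count-++ p (f x) (concatMap f xs)) (cong (count p (f x) +_) (count-concatMap p f xs))

sum-map-+ : ∀ (f g : A → ℕ) xs → sum (map (λ x → f x + g x) xs) ≡ sum (map f xs) + sum (map g xs)
sum-map-+ f g []       = refl
sum-map-+ f g (x ∷ xs) =
  trans (cong (f x + g x +_) (sum-map-+ f g xs)) (interchange +-commutativeSemigroup (f x) (g x) _ _)

sum-map-if : ∀ (p : A → Bool) (f : A → ℕ) c xs → (∀ {x} → x ∈ xs → T (p x) → f x ≡ c) →
  sum (map (λ x → if p x then f x else 0) xs) ≡ c * count p xs
sum-map-if p f c []       _     = sym (*-zeroʳ c)
sum-map-if p f c (x ∷ xs) f≡c rewrite count-∷ p x xs with p x in px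
... | true  = begin
  f x + sum (map _ xs)  ≡⟨ cong₂ _+_ (f≡c (here refl) (subst T (sym px) _)) (sum-map-if p f c xs (f≡c ∘ there)) ⟩
  c + c * count p xs    ≡⟨ *-suc c _ ⟨
  c * suc (count p xs)  ∎
  where open ≡-Reasoning
... | false = sum-map-if p f c xs (f≡c ∘ there)

count-↭ : ∀ (p : A → Bool) {xs ys} → xs ↭ ys → count p xs ≡ count p ys
count-↭ p = ↭-length ∘ filter-↭ (T? ∘ p)

unique∧sameMembers⇒↭ : ∀ {xs ys : List A} → Unique xs → Unique ys → (∀ {z} → z ∈ xs ⇔ z ∈ ys) → xs ↭ ys
unique∧sameMembers⇒↭ xs! ys! same = ∼bag⇒↭ (unique∧set⇒bag xs! ys! same)

concatMap-unique : ∀ (f : A → List B) {xs} → Unique xs →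
  (∀ {x} → x ∈ xs → Unique (f x)) →
  (∀ {x x′ y} → x ∈ xs → x′ ∈ xs → y ∈ f x → y ∈ f x′ → x ≡ x′) →
  Unique (concatMap f xs)
concatMap-unique f []           _        _         = []
concatMap-unique f (x∉xs ∷ xs!) f-unique separated =
  ++⁺ (f-unique (here refl))
      (concatMap-unique f xs! (f-unique ∘ there) (λ m m′ → separated (there m) (there m′)))
      λ (y∈fx , y∈rest) → let (x′ , x′∈xs , y∈fx′) = find (∈-concatMap⁻ f y∈rest) in
        All.lookup x∉xs x′∈xs (separated (here refl) (there x′∈xs) y∈fx y∈fx′)

sumBelow-recurrence : ∀ c (f g : ℕ → ℕ) → f 0 ≡ g 0 →
  (∀ k → f (suc k) ≡ suc (suc k) * g (suc k) + (c ∸ k) * g k) →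
  ∀ N → N ≤ c → sumBelow (suc N) f ≡ suc c * sumBelow N g + suc N * g N
sumBelow-recurrence c f g f₀ f-suc zero _ = begin
  f 0                 ≡⟨ f₀ ⟩
  g 0                 ≡⟨ +-identityʳ (g 0) ⟨
  1 * g 0             ≡⟨ cong (_+ 1 * g 0) (*-zeroʳ (suc c)) ⟨
  suc c * 0 + 1 * g 0 ∎
  where open ≡-Reasoning
sumBelow-recurrence c f g f₀ f-suc (suc N) 1+N≤c = begin
  sumBelow (suc N) f + f (suc N)
    ≡⟨ cong₂ _+_ (sumBelow-recurrence c f g f₀ f-suc N (<⇒≤ 1+N≤c)) (f-suc N) ⟩
  (suc c * S + suc N * g N) + (suc (suc N) * g (suc N) + (c ∸ N) * g N)
    ≡⟨ cong (λ d → (d * S + suc N * g N) + (suc (suc N) * g (suc N) + (c ∸ N) * g N)) (sym 1+N+[c∸N]≡1+c) ⟩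
  ((suc N + (c ∸ N)) * S + suc N * g N) + (suc (suc N) * g (suc N) + (c ∸ N) * g N)
    ≡⟨ regroup (suc N) (c ∸ N) S (g N) (g (suc N)) ⟩
  (suc N + (c ∸ N)) * (S + g N) + suc (suc N) * g (suc N)
    ≡⟨ cong (λ d → d * (S + g N) + suc (suc N) * g (suc N)) 1+N+[c∸N]≡1+c ⟩
  suc c * (S + g N) + suc (suc N) * g (suc N)
    ∎
  where
  open ≡-Reasoning
  S = sumBelow N g
  1+N+[c∸N]≡1+c : suc N + (c ∸ N) ≡ suc c
  1+N+[c∸N]≡1+c = cong suc (m+[n∸m]≡n (<⇒≤ 1+N≤c))
  regroup : ∀ n m a b x → ((n + m) * a + n * b) + (suc n * x + m * b) ≡ (n + m) * (a + b) + suc n * x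
  regroup = solve-∀

Letter : ℕ → ℕ → Set
Letter n a = 1 ≤ a × a ≤ n

∈-words⁺ : ∀ n {w} → All (Letter n) w → w ∈ words n (length w)
∈-words⁺ n []                                = here refl
∈-words⁺ n {suc a ∷ w} ((s≤s z≤n , a<n) ∷ ws) =
  ∈-concatMap⁺ (λ a → map (a ∷_) (words n (length w)))
    (lose (∈-map⁺ suc (∈-upTo⁺ a<n)) (∈-map⁺ (suc a ∷_) (∈-words⁺ n ws)))

∈-words⁻ : ∀ n L {w} → w ∈ words n L → length w ≡ L × All (Letter n) w
∈-words⁻ n zero    (here refl) = refl , []
∈-words⁻ n (suc L) w∈ with find (∈-concatMap⁻ (λ a → map (a ∷_) (words n L)) {map suc (upTo n)} w∈)
... | a , a∈ , w∈′ with ∈-map⁻ suc a∈ | ∈-map⁻ (a ∷_) w∈′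
... | i , i∈ , refl | v , v∈ , refl =
  let (len , letters) = ∈-words⁻ n L v∈ in cong suc len , (s≤s z≤n , ∈-upTo⁻ i∈) ∷ letters

words-unique : ∀ n L → Unique (words n L)
words-unique n zero    = [] ∷ []
words-unique n (suc L) =
  concatMap-unique (λ a → map (a ∷_) (words n L)) (unique-map⁺ suc-injective (upTo⁺ n))
    (λ _ → unique-map⁺ ∷-injectiveʳ (words-unique n L))
    λ _ _ y∈ y∈′ → let (_ , _ , y≡) = map∷⁻ y∈ ; (_ , _ , y≡′) = map∷⁻ y∈′ in
      ∷-injectiveˡ (trans (sym y≡) y≡′)

IsStirlingPerm : ℕ → ℕ → List ℕ → Set
IsStirlingPerm r n w =
  length w ≡ r * n × All (Letter n) w × (∀ i → i < n → occ (suc i) w ≡ r) × T (isStirlingCond w)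

T-allB : ∀ (p : A → Bool) xs → T (allB p xs) ⇔ All (T ∘ p) xs
T-allB p xs = mk⇔ (to xs) (from xs)
  where
  to : ∀ xs → T (allB p xs) → All (T ∘ p) xs
  to []       _ = []
  to (x ∷ xs) t = let (px , pxs) = Equivalence.to T-∧ t in px ∷ to xs pxs
  from : ∀ xs → All (T ∘ p) xs → T (allB p xs)
  from []       []         = _
  from (x ∷ xs) (px ∷ pxs) = Equivalence.from T-∧ (px , from xs pxs)

T-isMultisetPerm : ∀ r n w → T (isMultisetPerm r n w) ⇔ (∀ i → i < n → occ (suc i) w ≡ r)
T-isMultisetPerm r n w = mk⇔
  (λ t i i<n → ≡ᵇ⇒≡ _ _ (All.lookup (Equivalence.to (T-allB _ (upTo n)) t) (∈-upTo⁺ i<n)))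
  (λ oc1+N+[c∸N]≡1+c → Equivalence.from (T-allB _ (upTo n)) (All.tabulate λ i∈ → ≡⇒≡ᵇ _ _ (oc1+N+[c∸N]≡1+c _ (∈-upTo⁻ i∈))))

∈-stirlingPerms : ∀ r n {w} → w ∈ stirlingPerms r n ⇔ IsStirlingPerm r n w
∈-stirlingPerms r n {w} = mk⇔ to from
  where
  P? = λ w → T? (isMultisetPerm r n w ∧ isStirlingCond w)
  to : w ∈ stirlingPerms r n → IsStirlingPerm r n w
  to w∈ =
    let (w∈words , t)     = ∈-filter⁻ P? w∈
        (len , letters)   = ∈-words⁻ n (r * n) w∈words
        (multiset , stir) = Equivalence.to T-∧ t
    in len , letters , Equivalence.to (T-isMultisetPerm r n w) multiset , stir
  from : IsStirlingPerm r n w → w ∈ stirlingPerms r n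
  from (len , letters , oc1+N+[c∸N]≡1+c , stir) =
    ∈-filter⁺ P? (subst (λ L → w ∈ words n L) len (∈-words⁺ n letters))
      (Equivalence.from T-∧ (Equivalence.from (T-isMultisetPerm r n w) oc1+N+[c∸N]≡1+c , stir))

stirlingPerms-unique : ∀ r n → Unique (stirlingPerms r n)
stirlingPerms-unique r n = unique-filter⁺ _ (words-unique n (r * n))

stirlingPerms-zero : ∀ r → stirlingPerms r 0 ≡ [ [] ]
stirlingPerms-zero r rewrite *-zeroʳ r = refl

ones : ℕ → List ℕ
ones j = replicate j 1

noLater-map-suc : ∀ a w → noLater (suc a) (map suc w) ≡ noLater a w
noLater-map-suc a []      = refl
noLater-map-suc a (x ∷ w) = cong (if x ≡ᵇ a then false else_) (noLater-map-suc a w)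

condFrom-map-suc : ∀ a w → condFrom (suc a) (map suc w) ≡ condFrom a w
condFrom-map-suc a []      = refl
condFrom-map-suc a (x ∷ w) =
  cong₂ _∧_ (cong (if a <ᵇ x then_else true) (noLater-map-suc a w)) (condFrom-map-suc a w)

isStirlingCond-map-suc : ∀ w → isStirlingCond (map suc w) ≡ isStirlingCond w
isStirlingCond-map-suc []      = refl
isStirlingCond-map-suc (x ∷ w) = cong₂ _∧_ (condFrom-map-suc x w) (isStirlingCond-map-suc w)

descents-map-suc : ∀ w → descents (map suc w) ≡ descents w
descents-map-suc []          = refl
descents-map-suc (x ∷ [])    = refl
descents-map-suc (x ∷ y ∷ w) = cong ((if y <ᵇ x then 1 else 0) +_) (descents-map-suc (y ∷ w))

noLater-ones : ∀ a xs j ys → noLater (suc (suc a)) (xs ++ ones j ++ ys) ≡ noLater (suc (suc a)) (xs ++ ys)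
noLater-ones a []       zero    ys = refl
noLater-ones a []       (suc j) ys = noLater-ones a [] j ys
noLater-ones a (x ∷ xs) j       ys =
  cong (if x ≡ᵇ suc (suc a) then false else_) (noLater-ones a xs j ys)

condFrom-ones-prefix : ∀ a j ys → condFrom (suc a) (ones j ++ ys) ≡ condFrom (suc a) ys
condFrom-ones-prefix a zero    ys = refl
condFrom-ones-prefix a (suc j) ys = condFrom-ones-prefix a j ys

condFrom-ones : ∀ a xs j ys → condFrom (suc (suc a)) (xs ++ ones j ++ ys) ≡ condFrom (suc (suc a)) (xs ++ ys)
condFrom-ones a []       j ys = condFrom-ones-prefix (suc a) j ys
condFrom-ones a (x ∷ xs) j ys =
  cong₂ _∧_ (cong (if suc (suc a) <ᵇ x then_else true) (noLater-ones a xs j ys)) (condFrom-ones a xs j ys)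

noLater-one : ∀ {ys} → All (1 <_) ys → T (noLater 1 ys)
noLater-one []                     = _
noLater-one (s≤s (s≤s z≤n) ∷ ys>1) = noLater-one ys>1

condFrom-one : ∀ {ys} → All (1 <_) ys → T (condFrom 1 ys)
condFrom-one []                     = _
condFrom-one (s≤s (s≤s z≤n) ∷ ys>1) = Equivalence.from T-∧ (noLater-one ys>1 , condFrom-one ys>1)

isStirlingCond-ones-prefix : ∀ j {ys} → All (1 <_) ys → isStirlingCond (ones j ++ ys) ≡ isStirlingCond ys
isStirlingCond-ones-prefix zero    ys>1 = refl
isStirlingCond-ones-prefix (suc j) {ys} ys>1
  rewrite condFrom-ones-prefix 0 j ys | Equivalence.to T-≡ (condFrom-one ys>1) =
  isStirlingCond-ones-prefix j ys>1

isStirlingCond-ones : ∀ {xs} j {ys} → All (1 <_) xs → All (1 <_) ys →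
  isStirlingCond (xs ++ ones j ++ ys) ≡ isStirlingCond (xs ++ ys)
isStirlingCond-ones j [] ys>1 = isStirlingCond-ones-prefix j ys>1
isStirlingCond-ones {suc (suc x) ∷ xs} j {ys} (s≤s (s≤s z≤n) ∷ xs>1) ys>1 =
  cong₂ _∧_ (condFrom-ones x xs j ys) (isStirlingCond-ones j xs>1 ys>1)

descents-ones-prefix : ∀ j {ys} → All (1 <_) ys → descents (ones j ++ ys) ≡ descents ys
descents-ones-prefix zero          _                   = refl
descents-ones-prefix (suc zero)    []                  = refl
descents-ones-prefix (suc zero)    (s≤s (s≤s z≤n) ∷ _) = refl
descents-ones-prefix (suc (suc j)) ys>1                = descents-ones-prefix (suc j) ys>1

noLater-one⁻ : ∀ {xs} → All (1 ≤_) xs → T (noLater 1 xs) → All (1 <_) xs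
noLater-one⁻ {[]}               []         _ = []
noLater-one⁻ {suc (suc x) ∷ xs} (_ ∷ xs≥1) t = s≤s (s≤s z≤n) ∷ noLater-one⁻ xs≥1 t

ones-prefix : ∀ {xs} → All (1 ≤_) xs → T (condFrom 1 xs) → ∃₂ λ j s → xs ≡ ones j ++ s × All (1 <_) s
ones-prefix {[]}               []         _ = 0 , [] , refl , []
ones-prefix {suc zero ∷ xs}    (_ ∷ xs≥1) t with ones-prefix xs≥1 t
... | j , s , refl , s>1 = suc j , s , refl , s>1
ones-prefix {suc (suc x) ∷ xs} (_ ∷ xs≥1) t =
  0 , _ , refl , s≤s (s≤s z≤n) ∷ noLater-one⁻ xs≥1 (proj₁ (Equivalence.to T-∧ t))

ones-contiguous : ∀ {w} → All (1 ≤_) w → T (isStirlingCond w) →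
  ∃[ p ] ∃[ j ] ∃[ s ] w ≡ p ++ ones j ++ s × All (1 <_) p × All (1 <_) s
ones-contiguous {[]}              []        _ = [] , 0 , [] , refl , [] , []
ones-contiguous {suc zero ∷ w}    (_ ∷ w≥1) t with ones-prefix w≥1 (proj₁ (Equivalence.to T-∧ t))
... | j , s , refl , s>1 = [] , suc j , s , refl , [] , s>1
ones-contiguous {suc (suc x) ∷ w} (_ ∷ w≥1) t with ones-contiguous w≥1 (proj₂ (Equivalence.to T-∧ t))
... | p , j , s , refl , p>1 , s>1 = suc (suc x) ∷ p , j , s , refl , s≤s (s≤s z≤n) ∷ p>1 , s>1

oc1+N+[c∸N]≡1+ccount : ∀ a w → occ a w ≡ count (_≡ᵇ a) w
oc1+N+[c∸N]≡1+ccount a []      = refl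
oc1+N+[c∸N]≡1+ccount a (x ∷ w) rewrite count-∷ (_≡ᵇ a) x w with x ≡ᵇ a
... | true  = cong suc (oc1+N+[c∸N]≡1+ccount a w)
... | false = oc1+N+[c∸N]≡1+ccount a w

occ-zero : ∀ {w} → All (1 ≤_) w → occ 0 w ≡ 0
occ-zero []              = refl
occ-zero (s≤s z≤n ∷ w≥1) = occ-zero w≥1

map-pred-inverse : ∀ {u} → All (1 <_) u → All (1 ≤_) (map pred u) × map suc (map pred u) ≡ u
map-pred-inverse []               = [] , refl
map-pred-inverse (s≤s 1≤a ∷ u>1) = let (≥1 , lift) = map-pred-inverse u>1 in 1≤a ∷ ≥1 , cong (_ ∷_) lift

module _ (p s : List ℕ) {w : List ℕ} (w≥1 : All (1 ≤_) w) (lift : map suc w ≡ p ++ s) where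

  private
    p++s>1 : All (1 <_) (p ++ s)
    p++s>1 = subst (All (1 <_)) lift (All.map⁺ (All.map s≤s w≥1))

  length-insertOnes : ∀ j → length (p ++ ones j ++ s) ≡ j + length w
  length-insertOnes j = begin
    length (p ++ ones j ++ s)          ≡⟨ ↭-length (shifts p (ones j)) ⟩
    length (ones j ++ p ++ s)          ≡⟨ length-++ (ones j) ⟩
    length (ones j) + length (p ++ s)  ≡⟨ cong₂ _+_ (length-replicate j) (cong length (sym lift)) ⟩
    j + length (map suc w)             ≡⟨ cong (j +_) (length-map suc w) ⟩
    j + length w                       ∎
    where open ≡-Reasoning

  occ-insertOnes : ∀ j i → occ (suc i) (p ++ ones j ++ s) ≡ (if 0 ≡ᵇ i then j else 0) + occ i w
  occ-insertOnes j i = begin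
    occ (suc i) (p ++ ones j ++ s)                  ≡⟨ oc1+N+[c∸N]≡1+ccount (suc i) (p ++ ones j ++ s) ⟩
    count q (p ++ ones j ++ s)                      ≡⟨ count-↭ q (shifts p (ones j)) ⟩
    count q (ones j ++ p ++ s)                      ≡⟨ count-++ q (ones j) (p ++ s) ⟩
    count q (ones j) + count q (p ++ s)             ≡⟨ cong₂ _+_ (count-replicate q j 1) (cong (count q) (sym lift)) ⟩
    (if 0 ≡ᵇ i then j else 0) + count q (map suc w) ≡⟨ cong (_ +_) (count-map q suc w) ⟩
    (if 0 ≡ᵇ i then j else 0) + count (_≡ᵇ i) w     ≡⟨ cong (_ +_) (oc1+N+[c∸N]≡1+ccount i w) ⟨
    (if 0 ≡ᵇ i then j else 0) + occ i w             ∎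
    where
    open ≡-Reasoning
    q = _≡ᵇ suc i

  occ-one-insertOnes : ∀ j → occ 1 (p ++ ones j ++ s) ≡ j
  occ-one-insertOnes j = trans (occ-insertOnes j 0) (trans (cong (j +_) (occ-zero w≥1)) (+-identityʳ j))

  isStirlingCond-insertOnes : ∀ j → isStirlingCond (p ++ ones j ++ s) ≡ isStirlingCond w
  isStirlingCond-insertOnes j = begin
    isStirlingCond (p ++ ones j ++ s)  ≡⟨ isStirlingCond-ones j (All.++⁻ˡ p p++s>1) (All.++⁻ʳ p p++s>1) ⟩
    isStirlingCond (p ++ s)            ≡⟨ cong isStirlingCond lift ⟨
    isStirlingCond (map suc w)         ≡⟨ isStirlingCond-map-suc w ⟩
    isStirlingCond w                   ∎
    where open ≡-Reasoning

  letters-insertOnes : ∀ n j → All (Letter n) w ⇔ All (Letter (suc n)) (p ++ ones j ++ s)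
  letters-insertOnes n j = mk⇔
    (λ letters → All-resp-↭ (↭-sym (shifts p (ones j)))
      (All.++⁺ (All.replicate⁺ j (s≤s z≤n , s≤s z≤n))
        (subst (All (Letter (suc n))) lift (All.map⁺ (All.map (λ (_ , a≤n) → s≤s z≤n , s≤s a≤n) letters)))))
    (λ letters → All.zipWith (λ (1≤a , (_ , 1+a≤1+n)) → 1≤a , ≤-pred 1+a≤1+n)
      (w≥1 , All.map⁻ {f = suc} (subst (All (Letter (suc n))) (sym lift)
                        (All.++⁻ʳ (ones j) (All-resp-↭ (shifts p (ones j)) letters)))))

  isStirlingPerm-insertOnes : ∀ r n → IsStirlingPerm r n w ⇔ IsStirlingPerm r (suc n) (p ++ ones r ++ s)
  isStirlingPerm-insertOnes r n = length⇔ ×-⇔ letters-insertOnes n r ×-⇔ occ⇔ ×-⇔ stirling⇔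
    where
    length⇔ : length w ≡ r * n ⇔ length (p ++ ones r ++ s) ≡ r * suc n
    length⇔ = mk⇔
      (λ len → trans (length-insertOnes r) (trans (cong (r +_) len) (sym (*-suc r n))))
      (λ len → +-cancelˡ-≡ r _ _ (trans (sym (length-insertOnes r)) (trans len (*-suc r n))))
    occ⇔ : (∀ i → i < n → occ (suc i) w ≡ r) ⇔ (∀ i → i < suc n → occ (suc i) (p ++ ones r ++ s) ≡ r)
    occ⇔ = mk⇔
      (λ { oc1+N+[c∸N]≡1+c zero    _         → occ-one-insertOnes r
         ; oc1+N+[c∸N]≡1+c (suc i) (s≤s i<n) → trans (occ-insertOnes r (suc i)) (oc1+N+[c∸N]≡1+c i i<n) })
      (λ oc1+N+[c∸N]≡1+c i i<n → trans (sym (occ-insertOnes r (suc i))) (oc1+N+[c∸N]≡1+c (suc i) (s≤s i<n)))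
    stirling⇔ : T (isStirlingCond w) ⇔ T (isStirlingCond (p ++ ones r ++ s))
    stirling⇔ = mk⇔ (subst T (sym (isStirlingCond-insertOnes r))) (subst T (isStirlingCond-insertOnes r))

-- Inserting the block of 1s

-- b ++ [] rather than b, so that every member is literally of the form p ++ b ++ s.
insertEverywhere : List A → List A → List (List A)
insertEverywhere b []      = [ b ++ [] ]
insertEverywhere b (x ∷ u) = (b ++ x ∷ u) ∷ map (x ∷_) (insertEverywhere b u)

∈-insertEverywhere⁺ : ∀ (b : List A) p s → p ++ b ++ s ∈ insertEverywhere b (p ++ s)
∈-insertEverywhere⁺ b []      []      = here refl
∈-insertEverywhere⁺ b []      (x ∷ s) = here refl
∈-insertEverywhere⁺ b (x ∷ p) s       = there (∈-map⁺ (x ∷_) (∈-insertEverywhere⁺ b p s))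

∈-insertEverywhere⁻ : ∀ (b : List A) u {v} → v ∈ insertEverywhere b u →
  ∃₂ λ p s → u ≡ p ++ s × v ≡ p ++ b ++ s
∈-insertEverywhere⁻ b []      (here refl) = [] , [] , refl , refl
∈-insertEverywhere⁻ b (x ∷ u) (here refl) = [] , x ∷ u , refl , refl
∈-insertEverywhere⁻ b (x ∷ u) (there v∈)  with ∈-map⁻ (x ∷_) v∈
... | v′ , v′∈ , refl with ∈-insertEverywhere⁻ b u v′∈
... | p , s , refl , refl = x ∷ p , s , refl , refl

insertEverywhere-unique : ∀ {y : A} b {u} → All (y ≢_) u → Unique (insertEverywhere (y ∷ b) u)
insertEverywhere-unique b []          = [] ∷ []
insertEverywhere-unique b (y≢x ∷ y∉u) =
  All.tabulate (λ v∈ eq → let (_ , _ , v≡) = ∈-map⁻ _ v∈ in y≢x (∷-injectiveˡ (trans eq v≡)))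
  ∷ unique-map⁺ ∷-injectiveʳ (insertEverywhere-unique b y∉u)

insertOnes : ℕ → List ℕ → List (List ℕ)
insertOnes r w = insertEverywhere (ones r) (map suc w)

removeOnes : List ℕ → List ℕ
removeOnes = map pred ∘ filter (λ a → ¬? (a ≟ 1))

removeOnes-insertOnes : ∀ r {w v} → All (1 ≤_) w → v ∈ insertOnes r w → removeOnes v ≡ w
removeOnes-insertOnes r {w} w≥1 v∈ with ∈-insertEverywhere⁻ (ones r) (map suc w) v∈
... | p , s , lift , refl = begin
  map pred (filter ≢1? (p ++ ones r ++ s))
    ≡⟨ cong (map pred) (filter-++ ≢1? p (ones r ++ s)) ⟩
  map pred (filter ≢1? p ++ filter ≢1? (ones r ++ s))
    ≡⟨ cong (λ xs → map pred (filter ≢1? p ++ xs)) (filter-++ ≢1? (ones r) s) ⟩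
  map pred (filter ≢1? p ++ filter ≢1? (ones r) ++ filter ≢1? s)
    ≡⟨ cong (λ xs → map pred (filter ≢1? p ++ xs ++ filter ≢1? s)) (filter-none ≢1? (All.replicate⁺ r (λ ≢1 → ≢1 refl))) ⟩
  map pred (filter ≢1? p ++ filter ≢1? s)
    ≡⟨ cong (map pred) (filter-++ ≢1? p s) ⟨
  map pred (filter ≢1? (p ++ s))
    ≡⟨ cong (map pred ∘ filter ≢1?) lift ⟨
  map pred (filter ≢1? (map suc w))
    ≡⟨ cong (map pred) (filter-all ≢1? (All.map⁺ (All.map (λ 1≤a → >⇒≢ (s≤s 1≤a)) w≥1))) ⟩
  map pred (map suc w)
    ≡⟨ map-∘ w ⟨
  map (pred ∘ suc) w
    ≡⟨ map-id w ⟩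
  w ∎
  where
  open ≡-Reasoning
  ≢1? = λ a → ¬? (a ≟ 1)

stirlingPerm-insertOnes : ∀ r n {w z} → IsStirlingPerm r n w → z ∈ insertOnes r w → IsStirlingPerm r (suc n) z
stirlingPerm-insertOnes r n {w} σ@(_ , letters , _) z∈ with ∈-insertEverywhere⁻ (ones r) (map suc w) z∈
... | p , s , lift , refl = Equivalence.to (isStirlingPerm-insertOnes p s (All.map proj₁ letters) lift r n) σ

stirlingPerm-removeOnes : ∀ r n {z} → IsStirlingPerm r (suc n) z → ∃[ w ] IsStirlingPerm r n w × z ∈ insertOnes r w
stirlingPerm-removeOnes r n σ@(_ , letters , oc1+N+[c∸N]≡1+c , stir) with ones-contiguous (All.map proj₁ letters) stir
... | p , j , s , refl , p>1 , s>1 with map-pred-inverse (All.++⁺ p>1 s>1)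
... | w≥1 , lift with trans (sym (occ-one-insertOnes p s w≥1 lift j)) (oc1+N+[c∸N]≡1+c 0 (s≤s z≤n))
... | refl =
  map pred (p ++ s) ,
  Equivalence.from (isStirlingPerm-insertOnes p s w≥1 lift r n) σ ,
  subst (λ u → p ++ ones r ++ s ∈ insertEverywhere (ones r) u) (sym lift) (∈-insertEverywhere⁺ (ones r) p s)

stirlingPerms-letters≥1 : ∀ r n {w} → w ∈ stirlingPerms r n → All (1 ≤_) w
stirlingPerms-letters≥1 r n w∈ = All.map proj₁ (proj₁ (proj₂ (Equivalence.to (∈-stirlingPerms r n) w∈)))

stirlingPerms-suc : ∀ r n → stirlingPerms (suc r) (suc n) ↭ concatMap (insertOnes (suc r)) (stirlingPerms (suc r) n)
stirlingPerms-suc r n = unique∧sameMembers⇒↭ (stirlingPerms-unique R (suc n)) insertions-unique (mk⇔ to from)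
  where
  R = suc r
  ≥1 = stirlingPerms-letters≥1 R n
  insertions-unique : Unique (concatMap (insertOnes R) (stirlingPerms R n))
  insertions-unique = concatMap-unique (insertOnes R) (stirlingPerms-unique R n)
    (λ w∈ → insertEverywhere-unique (ones r) (All.map⁺ (All.map (λ 1≤a → <⇒≢ (s≤s 1≤a)) (≥1 w∈))))
    (λ w∈ w′∈ v∈ v∈′ → trans (sym (removeOnes-insertOnes R (≥1 w∈) v∈)) (removeOnes-insertOnes R (≥1 w′∈) v∈′))
  to : ∀ {z} → z ∈ stirlingPerms R (suc n) → z ∈ concatMap (insertOnes R) (stirlingPerms R n)
  to z∈ =
    let (w , σ , z∈ins) = stirlingPerm-removeOnes R n (Equivalence.to (∈-stirlingPerms R (suc n)) z∈)
    in ∈-concatMap⁺ (insertOnes R) (lose (Equivalence.from (∈-stirlingPerms R n) σ) z∈ins)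
  from : ∀ {z} → z ∈ concatMap (insertOnes R) (stirlingPerms R n) → z ∈ stirlingPerms R (suc n)
  from z∈ =
    let (w , w∈ , z∈ins) = find (∈-concatMap⁻ (insertOnes R) z∈)
    in Equivalence.from (∈-stirlingPerms R (suc n)) (stirlingPerm-insertOnes R n (Equivalence.to (∈-stirlingPerms R n) w∈) z∈ins)

-- Descents of the insertions

-- The slots behind the letters of u at which inserting letters smaller than all of u increases
-- the number of descents: the non-descents of u and its end.
ascentSlots : List ℕ → ℕ
ascentSlots []          = 0
ascentSlots (x ∷ [])    = 1
ascentSlots (x ∷ y ∷ u) = (if y <ᵇ x then 0 else 1) + ascentSlots (y ∷ u)

ascentSlots+descents : ∀ u → ascentSlots u + descents u ≡ length u
ascentSlots+descents []          = refl
ascentSlots+descents (x ∷ [])    = refl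
ascentSlots+descents (x ∷ y ∷ u) with ascentSlots+descents (y ∷ u) | y <ᵇ x
... | ih | true  = trans (+-suc _ _) (cong suc ih)
... | ih | false = cong suc ih

descentMultiset : ℕ → ℕ → List ℕ
descentMultiset d e = replicate d d ++ replicate e (suc d)

descents-cons : ∀ x y ws →
  map descents (map (x ∷_) (map (y ∷_) ws)) ≡ map ((if y <ᵇ x then 1 else 0) +_) (map descents (map (y ∷_) ws))
descents-cons x y []       = refl
descents-cons x y (w ∷ ws) = cong (_ ∷_) (descents-cons x y ws)

descentMultiset-cons : ∀ b d e →
  suc d ∷ map ((if b then 1 else 0) +_) (descentMultiset d e) ↭
  descentMultiset ((if b then 1 else 0) + d) ((if b then 0 else 1) + e)
descentMultiset-cons true  d e = ↭-reflexive (cong (suc d ∷_) (begin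
  map suc (replicate d d ++ replicate e (suc d))           ≡⟨ map-++ suc (replicate d d) _ ⟩
  map suc (replicate d d) ++ map suc (replicate e (suc d)) ≡⟨ cong₂ _++_ (map-replicate suc d d) (map-replicate suc e (suc d)) ⟩
  replicate d (suc d) ++ replicate e (suc (suc d))         ∎))
  where open ≡-Reasoning
descentMultiset-cons false d e = begin
  suc d ∷ map (0 +_) (descentMultiset d e)      ≡⟨ cong (suc d ∷_) (map-id _) ⟩
  suc d ∷ replicate d d ++ replicate e (suc d)  ↭⟨ shift (suc d) (replicate d d) _ ⟨
  replicate d d ++ suc d ∷ replicate e (suc d)  ∎
  where open PermutationReasoning

-- map (x ∷_) (insertEverywhere b u) lists the insertions of b into x ∷ u behind its first letter.
tailInsertions-descents : ∀ r x u → All (1 <_) (x ∷ u) →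
  map descents (map (x ∷_) (insertEverywhere (ones (suc r)) u)) ↭
  descentMultiset (descents (x ∷ u)) (ascentSlots (x ∷ u))
tailInsertions-descents r (suc (suc x)) [] (s≤s (s≤s z≤n) ∷ []) =
  ↭-reflexive (cong (λ d → [ suc d ]) (descents-ones-prefix (suc r) []))
tailInsertions-descents r (suc (suc x)) (y ∷ u) (s≤s (s≤s z≤n) ∷ y∷u>1) = begin
  descents (suc (suc x) ∷ ones (suc r) ++ y ∷ u) ∷ map descents (map (suc (suc x) ∷_) (map (y ∷_) I))
    ≡⟨ cong₂ _∷_ (cong suc (descents-ones-prefix (suc r) y∷u>1)) (descents-cons (suc (suc x)) y I) ⟩
  suc d ∷ map (c +_) (map descents (map (y ∷_) I))
    ↭⟨ prep (suc d) (↭-map⁺ (c +_) (tailInsertions-descents r y u y∷u>1)) ⟩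
  suc d ∷ map (c +_) (descentMultiset d (ascentSlots (y ∷ u)))
    ↭⟨ descentMultiset-cons (y <ᵇ suc (suc x)) d (ascentSlots (y ∷ u)) ⟩
  descentMultiset (c + d) (ascentSlots (suc (suc x) ∷ y ∷ u))
    ∎
  where
  open PermutationReasoning
  I = insertEverywhere (ones (suc r)) u
  d = descents (y ∷ u)
  c = if y <ᵇ suc (suc x) then 1 else 0

insertEverywhere-ones-descents : ∀ r u → All (1 <_) u →
  map descents (insertEverywhere (ones (suc r)) u) ↭ descents u ∷ descentMultiset (descents u) (ascentSlots u)
insertEverywhere-ones-descents r []      []  = ↭-reflexive (cong [_] (descents-ones-prefix (suc r) []))
insertEverywhere-ones-descents r (x ∷ u) u>1
  rewrite descents-ones-prefix (suc r) u>1 = prep (descents (x ∷ u)) (tailInsertions-descents r x u u>1)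

hasDescents : ℕ → List ℕ → Bool
hasDescents k w = descents w ≡ᵇ k

count-hasDescents-insertOnes : ∀ r k {w} → All (1 ≤_) w →
  count (hasDescents k) (insertOnes (suc r) w) ≡
  (if descents w ≡ᵇ k then suc (descents w) else 0) + (if suc (descents w) ≡ᵇ k then length w ∸ descents w else 0)
count-hasDescents-insertOnes r k {w} w≥1 = begin
  count (hasDescents k) (insertEverywhere (ones (suc r)) u)
    ≡⟨ count-map (_≡ᵇ k) descents (insertEverywhere (ones (suc r)) u) ⟨
  count (_≡ᵇ k) (map descents (insertEverywhere (ones (suc r)) u))
    ≡⟨ count-↭ (_≡ᵇ k) (insertEverywhere-ones-descents r u (All.map⁺ (All.map s≤s w≥1))) ⟩
  count (_≡ᵇ k) (replicate (suc d) d ++ replicate e (suc d))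
    ≡⟨ count-++ (_≡ᵇ k) (replicate (suc d) d) (replicate e (suc d)) ⟩
  count (_≡ᵇ k) (replicate (suc d) d) + count (_≡ᵇ k) (replicate e (suc d))
    ≡⟨ cong₂ _+_ (count-replicate (_≡ᵇ k) (suc d) d) (count-replicate (_≡ᵇ k) e (suc d)) ⟩
  (if d ≡ᵇ k then suc d else 0) + (if suc d ≡ᵇ k then e else 0)
    ≡⟨ cong₂ (λ d e → (if d ≡ᵇ k then suc d else 0) + (if suc d ≡ᵇ k then e else 0)) (descents-map-suc w) e≡ ⟩
  (if descents w ≡ᵇ k then suc (descents w) else 0) + (if suc (descents w) ≡ᵇ k then length w ∸ descents w else 0)
    ∎
  where
  open ≡-Reasoning
  u = map suc w
  d = descents u
  e = ascentSlots u
  e≡ : e ≡ length w ∸ descents w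
  e≡ = begin
    e                      ≡⟨ m+n∸n≡m e d ⟨
    e + d ∸ d              ≡⟨ cong₂ _∸_ (trans (ascentSlots+descents u) (length-map suc w)) (descents-map-suc w) ⟩
    length w ∸ descents w  ∎

-- The recurrence and its two consequences

Tr-order-zero : ∀ r k → Tr r 0 k ≡ (if 0 ≡ᵇ k then 1 else 0)
Tr-order-zero r zero    = cong (count (hasDescents 0)) (stirlingPerms-zero r)
Tr-order-zero r (suc k) = cong (count (hasDescents (suc k))) (stirlingPerms-zero r)

Tr-suc : ∀ r n k → Tr (suc r) (suc n) k ≡
  suc k * Tr (suc r) n k +
  sum (map (λ w → if suc (descents w) ≡ᵇ k then length w ∸ descents w else 0) (stirlingPerms (suc r) n))
Tr-suc r n k = begin
  Tr R (suc n) k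
    ≡⟨ count-↭ (hasDescents k) (stirlingPerms-suc r n) ⟩
  count (hasDescents k) (concatMap (insertOnes R) SP)
    ≡⟨ count-concatMap (hasDescents k) (insertOnes R) SP ⟩
  sum (map (count (hasDescents k) ∘ insertOnes R) SP)
    ≡⟨ cong sum (map-cong-local (All.tabulate λ w∈ → count-hasDescents-insertOnes r k (stirlingPerms-letters≥1 R n w∈))) ⟩
  sum (map (λ w → kept w + added w) SP)
    ≡⟨ sum-map-+ kept added SP ⟩
  sum (map kept SP) + sum (map added SP)
    ≡⟨ cong (_+ sum (map added SP)) (sum-map-if (hasDescents k) (suc ∘ descents) (suc k) SP λ _ t → cong suc (≡ᵇ⇒≡ _ _ t)) ⟩
  suc k * Tr R n k + sum (map added SP)
    ∎
  where
  open ≡-Reasoning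
  R = suc r
  SP = stirlingPerms R n
  kept added : List ℕ → ℕ
  kept  w = if descents w ≡ᵇ k then suc (descents w) else 0
  added w = if suc (descents w) ≡ᵇ k then length w ∸ descents w else 0

Tr-suc-zero : ∀ r n → Tr (suc r) (suc n) 0 ≡ Tr (suc r) n 0
Tr-suc-zero r n = begin
  Tr (suc r) (suc n) 0                                 ≡⟨ Tr-suc r n 0 ⟩
  1 * Tr (suc r) n 0 + sum (map (λ _ → 0) (stirlingPerms (suc r) n))
    ≡⟨ cong (1 * Tr (suc r) n 0 +_) (sum-map-if (λ _ → false) (λ _ → 0) 0 (stirlingPerms (suc r) n) λ _ ()) ⟩
  1 * Tr (suc r) n 0 + 0                               ≡⟨ +-identityʳ _ ⟩
  1 * Tr (suc r) n 0                                   ≡⟨ *-identityˡ _ ⟩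
  Tr (suc r) n 0                                       ∎
  where open ≡-Reasoning

Tr-suc-suc : ∀ r n k → Tr (suc r) (suc n) (suc k) ≡
  suc (suc k) * Tr (suc r) n (suc k) + (suc r * n ∸ k) * Tr (suc r) n k
Tr-suc-suc r n k = trans (Tr-suc r n (suc k)) (cong (suc (suc k) * Tr (suc r) n (suc k) +_)
  (sum-map-if (hasDescents k) (λ w → length w ∸ descents w) (suc r * n ∸ k) (stirlingPerms (suc r) n)
    λ {w} w∈ t → cong₂ _∸_ (proj₁ (Equivalence.to (∈-stirlingPerms (suc r) n) w∈)) (≡ᵇ⇒≡ (descents w) k t)))

Tr-vanishes : ∀ r n k → n < k → Tr (suc r) (suc n) k ≡ 0
Tr-vanishes r zero    (suc k) _ = begin
  Tr R 1 (suc k)                                           ≡⟨ Tr-suc-suc r 0 k ⟩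
  suc (suc k) * Tr R 0 (suc k) + (R * 0 ∸ k) * Tr R 0 k
    ≡⟨ cong₂ (λ t c → suc (suc k) * t + (c ∸ k) * Tr R 0 k) (Tr-order-zero R (suc k)) (*-zeroʳ R) ⟩
  suc (suc k) * 0 + (0 ∸ k) * Tr R 0 k                     ≡⟨ cong₂ _+_ (*-zeroʳ (suc (suc k))) (cong (_* Tr R 0 k) (0∸n≡0 k)) ⟩
  0                                                        ∎
  where
  open ≡-Reasoning
  R = suc r
Tr-vanishes r (suc n) (suc k) (s≤s n<k) = begin
  Tr R (suc (suc n)) (suc k)                                   ≡⟨ Tr-suc-suc r (suc n) k ⟩
  suc (suc k) * Tr R (suc n) (suc k) + c * Tr R (suc n) k
    ≡⟨ cong₂ (λ a b → suc (suc k) * a + c * b) (Tr-vanishes r n (suc k) (m<n⇒m<1+n n<k)) (Tr-vanishes r n k n<k) ⟩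
  suc (suc k) * 0 + c * 0                                      ≡⟨ cong₂ _+_ (*-zeroʳ (suc (suc k))) (*-zeroʳ c) ⟩
  0                                                            ∎
  where
  open ≡-Reasoning
  R = suc r
  c = R * suc n ∸ k

stirlingProduct : ℕ → ℕ → ℕ
stirlingProduct r zero    = 1
stirlingProduct r (suc n) = suc (r * suc n) * stirlingProduct r n

Tr-rowSum : ∀ r n → sumBelow (suc n) (Tr (suc r) (suc n)) ≡ stirlingProduct (suc r) n
Tr-rowSum r zero    = trans (Tr-suc-zero r 0) (Tr-order-zero (suc r) 0)
Tr-rowSum r (suc n) = begin
  sumBelow (suc N) (Tr R (suc N))
    ≡⟨ sumBelow-recurrence (R * N) (Tr R (suc N)) (Tr R N) (Tr-suc-zero r N) (Tr-suc-suc r N) N (m≤n*m N R) ⟩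
  suc (R * N) * sumBelow N (Tr R N) + suc N * Tr R N N
    ≡⟨ cong₂ (λ a b → suc (R * N) * a + suc N * b) (Tr-rowSum r n) (Tr-vanishes r n N ≤-refl) ⟩
  suc (R * N) * stirlingProduct R n + suc N * 0
    ≡⟨ trans (cong (suc (R * N) * stirlingProduct R n +_) (*-zeroʳ (suc N))) (+-identityʳ _) ⟩
  stirlingProduct R N
    ∎
  where
  open ≡-Reasoning
  R = suc r
  N = suc n

Tr-maxDescents : ∀ r n → Tr (suc (suc r)) (suc n) n ≡ stirlingProduct (suc r) n
Tr-maxDescents r zero    = trans (Tr-suc-zero (suc r) 0) (Tr-order-zero (suc (suc r)) 0)
Tr-maxDescents r (suc n) = begin
  Tr R (suc (suc n)) (suc n)                                  ≡⟨ Tr-suc-suc (suc r) (suc n) n ⟩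
  suc (suc n) * Tr R (suc n) (suc n) + (R * suc n ∸ n) * Tr R (suc n) n
    ≡⟨ cong₂ (λ a b → suc (suc n) * a + (R * suc n ∸ n) * b) (Tr-vanishes (suc r) n (suc n) ≤-refl) (Tr-maxDescents r n) ⟩
  suc (suc n) * 0 + (R * suc n ∸ n) * stirlingProduct (suc r) n
    ≡⟨ cong₂ _+_ (*-zeroʳ (suc (suc n))) (cong (_* stirlingProduct (suc r) n) coefficient) ⟩
  stirlingProduct (suc r) (suc n)                             ∎
  where
  open ≡-Reasoning
  R = suc (suc r)
  X = suc r * suc n
  coefficient : R * suc n ∸ n ≡ suc X
  coefficient = trans (cong (_∸ n) (sym (+-suc n X))) (m+n∸m≡n n (suc X))

theorem4p3 : (m n : ℕ) → 2 ≤ m → 1 ≤ n →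
    sumBelow n (Tr (m ∸ 1) n) ≡ Tr m n (n ∸ 1)
theorem4p3 (suc (suc r)) (suc n) (s≤s (s≤s z≤n)) (s≤s z≤n) = trans (Tr-rowSum r n) (sym (Tr-maxDescents r n))
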